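{- Let $I$ be a superpermutation. Then $J\mapsto\alpha(J)$ is a poset isomorphism from $I^{\uparrow}=\{J: I\preceq J\}$ onto $\gamma(I)^{\downarrow}=\{\beta:\beta\preceq\gamma(I)\}$.
   Context: A set supercomposition of bidegree $(n,m)$ is a sequence $(I_1,\ldots,I_k)$ of nonempty subsets of $\{0,\ldots,n\}$ with $I_i\cap I_j\subseteq\{0\}$ ($i\ne j$), $\bigcup(I_i\setminus\{0\})=[n]$, $m$ blocks containing $0$ (fermionic). Order on set supercompositions: $J$ covers $I=(I_1,\ldots,I_k)$ if for some $i$, $I_i,I_{i+1}$ are non-fermionic, $\max I_i<\min I_{i+1}$, and $J=(I_1,\ldots,I_{i-1},I_i\cup I_{i+1},I_{i+2},\ldots,I_k)$; $\preceq$ is the reflexive-transitive closure. A superpermutation is a set supercomposition whose non-fermionic blocks are singletons. A dotted composition is a finite sequence of entries that are positive integers (undotted) or $\dot a$, $a\in\mathbb{N}_0$. Order: $\beta$ covers $\alpha$ if $\beta$ is obtained by replacing two adjacent undotted entries $\alpha_i,\alpha_{i+1}$ by their sum; $\preceq$ is the reflexive-transitive closure. For a set supercomposition $J=(J_1,\ldots,J_k)$, $\alpha(J)=(\alpha_1,\ldots,\alpha_k)$ with $\alpha_i=|J_i\setminus\{0\}|$ undotted if $0\notin J_i$ and dotted if $0\in J_i$. For a superpermutation $I$: a non-fermionic segment is a maximal interval $[p,q]$ of indices with all $I_p,\ldots,I_q$ non-fermionic, $I_i=\{a_i\}$; if $d_1<\cdots<d_s$ are the $d\in[q-p]$ with $a_{p+d-1}>a_{p+d}$,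 set $\alpha_{[p,q]}=(d_1,d_2-d_1,\ldots,(q-p+1)-d_s)$ (or $(q-p+1)$ if $s=0$). $\gamma(I)$ is the concatenation, in order of appearance, of a part $\dot a$ with $a=|I_i|-1$ for each fermionic block $I_i$ and $\alpha_{[p,q]}$ for each non-fermionic segment. -}

module Defs where

open import Data.Nat using (ℕ; zero; suc; _+_; _∸_; _<_; _<?_)
open import Data.Bool using (Bool; true; false; if_then_else_)
open import Data.List using (List; []; _∷_; _++_; length; filter; map; lookup)
open import Data.Vec using (Vec; []; _∷_)
open import Data.Fin using (Fin; toℕ) renaming (zero to fzero; suc to fsuc)
open import Data.Fin.Subset using (Subset; _∈_; _∉_; _∪_; _-_; ∣_∣; ⁅_⁆; Nonempty)
open import Data.Fin.Subset.Properties using (_∈?_)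
open import Data.Product using (∃; _×_)
open import Data.Unit using (⊤)
open import Data.List.Relation.Unary.All using (All)
open import Relation.Nullary using (¬_; does)
open import Relation.Binary.PropositionalEquality using (_≡_)
open import Relation.Binary.Construct.Closure.ReflexiveTransitive using (Star)

Block : ℕ → Set
Block n = Subset (suc n)

Fermionic : ∀ {n} → Block n → Set
Fermionic B = fzero ∈ B

isFermionic : ∀ {n} → Block n → Bool
isFermionic B = does (fzero ∈? B)

record IsSetSupercomp (n m : ℕ) (I : List (Block n)) : Set where
  field
    nonempty  : All Nonempty I
    disjoint  : ∀ (i j : Fin (length I)) → ¬ (i ≡ j) →
                ∀ x → x ∈ lookup I i → x ∈ lookup I j → x ≡ fzero
    covering  : ∀ (x : Fin n) → ∃ λ (i : Fin (length I)) → fsuc x ∈ lookup I i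
    fermCount : length (filter (λ B → fzero ∈? B) I) ≡ m

record IsSuperperm (n m : ℕ) (I : List (Block n)) : Set where
  field
    setSupercomp : IsSetSupercomp n m I
    singletons   : All (λ B → fzero ∉ B → ∃ λ a → B ≡ ⁅ a ⁆) I

data CoverS {n : ℕ} : List (Block n) → List (Block n) → Set where
  here  : ∀ {B C rest} → fzero ∉ B → fzero ∉ C →
          (∀ x y → x ∈ B → y ∈ C → toℕ x < toℕ y) →
          CoverS (B ∷ C ∷ rest) ((B ∪ C) ∷ rest)
  there : ∀ {B xs ys} → CoverS xs ys → CoverS (B ∷ xs) (B ∷ ys)

_⪯_ : ∀ {n} → List (Block n) → List (Block n) → Set
_⪯_ = Star CoverS

data Entry : Set where
  undot : ℕ → Entry   -- undotted entry a (must be positive, see IsDotComp)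
  dot   : ℕ → Entry   -- dotted entry ȧ, a ∈ ℕ₀

PosEntry : Entry → Set
PosEntry (undot a) = 0 < a
PosEntry (dot _)   = ⊤

IsDotComp : List Entry → Set
IsDotComp = All PosEntry

data CoverD : List Entry → List Entry → Set where
  here  : ∀ {a b rest} → CoverD (undot a ∷ undot b ∷ rest) (undot (a + b) ∷ rest)
  there : ∀ {e xs ys} → CoverD xs ys → CoverD (e ∷ xs) (e ∷ ys)

_⊑_ : List Entry → List Entry → Set
_⊑_ = Star CoverD

αblock : ∀ {n} → Block n → Entry
αblock B = if isFermionic B then dot ∣ B - fzero ∣ else undot ∣ B - fzero ∣

αc : ∀ {n} → List (Block n) → List Entry
αc = map αblock

minElem : ∀ {k} → Subset k → ℕ
minElem []          = 0
minElem (true  ∷ _) = 0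
minElem (false ∷ p) = suc (minElem p)

at : List ℕ → ℕ → ℕ
at []       _       = 0
at (x ∷ _)  zero    = x
at (_ ∷ xs) (suc i) = at xs i

oneTo : ℕ → List ℕ
oneTo zero    = []
oneTo (suc k) = oneTo k ++ (suc k ∷ [])

-- descents d ∈ [L-1] (L = length of segment a_1 … a_L) with a_d > a_{d+1};
-- with 0-indexing this is at as (d ∸ 1) > at as d
descents : List ℕ → List ℕ
descents as = filter (λ d → at as d <? at as (d ∸ 1)) (oneTo (length as ∸ 1))

diffs : ℕ → List ℕ → List ℕ
diffs _    []       = []
diffs prev (x ∷ xs) = (x ∸ prev) ∷ diffs x xs

segComp : List ℕ → List ℕ
segComp as = diffs 0 (descents as ++ (length as ∷ []))

flush : List ℕ → List Entry
flush []        = []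
flush (a ∷ as)  = map undot (segComp (a ∷ as))

γaux : ∀ {n} → List ℕ → List (Block n) → List Entry
γaux seg []       = flush seg
γaux seg (B ∷ Bs) =
  if isFermionic B
  then flush seg ++ (dot ∣ B - fzero ∣ ∷ γaux [] Bs)
  else γaux (seg ++ (minElem B ∷ [])) Bs

γ : ∀ {n} → List (Block n) → List Entry
γ = γaux []

-- Write the superpermutation I as a word w of tokens: its fermionic blocks and its singletons {a}.
-- Covering steps only merge adjacent non-fermionic blocks lying in increasing order, so every J ⪰ I
-- is the list of blocks of a chunking of w: a cutting of w into fermionic blocks and increasing runs
-- of singletons, with α(J) the list of chunk sizes. A chunking is determined by its word and its
-- sizes (injectivity). A covering β ⋖ α(c) splits one run of c into two shorter increasing runs, so
-- ⊑ below α(c) lifts to ⪯ below the blocks of c (surjectivity and the order). Finally every α(c) lies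
-- below α of the coarsest chunking, which cuts w only at fermions and at descents and hence has
-- α = γ(I).
module Submission where

open import Defs
open import Data.Bool using (true; false; if_then_else_)
open import Data.Empty using (⊥-elim)
open import Data.Fin as Fin using (Fin; toℕ) renaming (zero to fzero; suc to fsuc)
import Data.Fin.Properties as Finₚ
open import Data.Fin.Subset using (Subset; inside; outside; _∈_; _∉_; _∪_; ⁅_⁆; ⋃; ∣_∣)
open import Data.Fin.Subset.Properties
  using (p─⊥≡p; ∪-identityˡ; ∪-identityʳ; ∪-assoc; x∈p∪q⁻; p⊆p∪q; q⊆p∪q; x∈⁅x⁆; x∈⁅y⁆⇒x≡y; ∉⊥; ∣⊥∣≡0; ∣⁅x⁆∣≡1)
open import Data.List
  using (List; []; _∷_; _++_; [_]; map; concatMap; length; take; drop; filter; upTo; applyUpTo)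
open import Data.List.Properties
  using (map-++; ++-assoc; ++-identityʳ; ∷-injective; ∷-injectiveˡ; ∷-injectiveʳ; take++drop≡id;
         length-take; length-drop; tabulate-lookup; filter-accept; filter-reject; map-applyUpTo; upTo-∷ʳ)
open import Data.List.Membership.Propositional using () renaming (_∈_ to _∈ₗ_)
open import Data.List.Relation.Unary.All as All using (All; []; _∷_)
import Data.List.Relation.Unary.All.Properties as Allₚ
open import Data.List.Relation.Unary.AllPairs using (AllPairs; []; _∷_)
import Data.List.Relation.Unary.AllPairs.Properties as AllPairsₚ
open import Data.List.Relation.Unary.Any using (here; there)
open import Data.List.Relation.Unary.Linked as Linked using (Linked; []; [-]; _∷_)
import Data.List.Relation.Unary.Linked.Properties as Linkedₚ
open import Data.Nat as ℕ using (ℕ; zero; suc; _+_; _∸_; _⊓_)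
import Data.Nat.Properties as ℕ
open import Data.Product using (∃; ∃₂; _×_; _,_)
open import Data.Sum using ([_,_]′)
open import Data.Unit using (⊤; tt)
open import Data.Vec using ([]; _∷_; here; there)
open import Function using (_∘_; id)
open import Function.Bundles using (_⇔_; mk⇔)
open import Relation.Nullary using (¬_; yes; no; does)
open import Relation.Nullary.Reflects using (ofʸ; ofⁿ)
open import Relation.Unary using (Decidable)
open import Relation.Binary.Construct.Closure.ReflexiveTransitive using (ε; _◅_; _◅◅_; gmap)
open import Relation.Binary.PropositionalEquality hiding ([_])
open ≡-Reasoning

-- Lists and subsets

AllPairs-++⁻ : ∀ {A : Set} {R : A → A → Set} (xs : List A) {ys} → AllPairs R (xs ++ ys) →
               AllPairs R xs × AllPairs R ys × All (λ x → All (R x) ys) xs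
AllPairs-++⁻ []       Rys        = [] , Rys , []
AllPairs-++⁻ (x ∷ xs) (Rx ∷ Rxs) with AllPairs-++⁻ xs Rxs
... | Rxs′ , Rys , Rxsys = Allₚ.++⁻ˡ xs Rx ∷ Rxs′ , Rys , Allₚ.++⁻ʳ xs Rx ∷ Rxsys

split-lengths : ∀ {A : Set} a {b} (zs : List A) → length zs ≡ a + b →
                ∃₂ λ p q → p ++ q ≡ zs × length p ≡ a × length q ≡ b
split-lengths a {b} zs len =
  take a zs , drop a zs , take++drop≡id a zs ,
  trans (length-take a zs) (trans (cong (a ⊓_) len) (ℕ.m≤n⇒m⊓n≡m (ℕ.m≤m+n a b))) ,
  trans (length-drop a zs) (trans (cong (_∸ a) len) (ℕ.m+n∸m≡n a b))

filter-map : ∀ {A B : Set} (f : A → B) {P : B → Set} (P? : Decidable P) xs →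
             filter P? (map f xs) ≡ map f (filter (P? ∘ f) xs)
filter-map f P? []       = refl
filter-map f P? (x ∷ xs) with does (P? (f x))
... | true  = cong (f x ∷_) (filter-map f P? xs)
... | false = filter-map f P? xs

∣p∪q∣≡∣p∣+∣q∣ : ∀ {k} (p q : Subset k) → (∀ {x} → x ∈ p → x ∉ q) → ∣ p ∪ q ∣ ≡ ∣ p ∣ + ∣ q ∣
∣p∪q∣≡∣p∣+∣q∣ []      []      _ = refl
∣p∪q∣≡∣p∣+∣q∣ (s ∷ p) (t ∷ q) p∩q=∅ with ∣p∪q∣≡∣p∣+∣q∣ p q (λ x∈p x∈q → p∩q=∅ (there x∈p) (there x∈q))
... | ih with s | t
... | inside  | inside  = ⊥-elim (p∩q=∅ here here)
... | inside  | outside = cong suc ih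
... | outside | inside  = trans (cong suc ih) (sym (ℕ.+-suc ∣ p ∣ ∣ q ∣))
... | outside | outside = ih

⋃-++ : ∀ {k} (ps qs : List (Subset k)) → ⋃ (ps ++ qs) ≡ ⋃ ps ∪ ⋃ qs
⋃-++ []       qs = sym (∪-identityˡ (⋃ qs))
⋃-++ (p ∷ ps) qs = trans (cong (p ∪_) (⋃-++ ps qs)) (sym (∪-assoc p (⋃ ps) (⋃ qs)))

∈⋃⁅⁆⁻ : ∀ {k} (xs : List (Fin k)) {x} → x ∈ ⋃ (map ⁅_⁆ xs) → x ∈ₗ xs
∈⋃⁅⁆⁻ []       x∈⊥ = ⊥-elim (∉⊥ x∈⊥)
∈⋃⁅⁆⁻ (a ∷ xs) x∈  = [ here ∘ x∈⁅y⁆⇒x≡y a , there ∘ ∈⋃⁅⁆⁻ xs ]′ (x∈p∪q⁻ ⁅ a ⁆ _ x∈)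

∈⋃⁅⁆⁺ : ∀ {k} {xs : List (Fin k)} {x} → x ∈ₗ xs → x ∈ ⋃ (map ⁅_⁆ xs)
∈⋃⁅⁆⁺ {xs = a ∷ xs} (here refl) = p⊆p∪q _ (x∈⁅x⁆ a)
∈⋃⁅⁆⁺ {xs = a ∷ xs} (there x∈) = q⊆p∪q ⁅ a ⁆ _ (∈⋃⁅⁆⁺ x∈)

∣⋃⁅⁆∣ : ∀ {k} {xs : List (Fin k)} → AllPairs Fin._<_ xs → ∣ ⋃ (map ⁅_⁆ xs) ∣ ≡ length xs
∣⋃⁅⁆∣ {k} [] = ∣⊥∣≡0 k
∣⋃⁅⁆∣ {xs = a ∷ xs} (a<xs ∷ increasing) = begin
  ∣ ⁅ a ⁆ ∪ ⋃ (map ⁅_⁆ xs) ∣          ≡⟨ ∣p∪q∣≡∣p∣+∣q∣ _ _ a∉xs ⟩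
  ∣ ⁅ a ⁆ ∣ + ∣ ⋃ (map ⁅_⁆ xs) ∣      ≡⟨ cong₂ _+_ (∣⁅x⁆∣≡1 a) (∣⋃⁅⁆∣ increasing) ⟩
  suc (length xs)                    ∎
  where
  a∉xs : ∀ {x} → x ∈ ⁅ a ⁆ → x ∉ ⋃ (map ⁅_⁆ xs)
  a∉xs x∈⁅a⁆ x∈xs with refl ← x∈⁅y⁆⇒x≡y a x∈⁅a⁆ = ℕ.<-irrefl refl (All.lookup a<xs (∈⋃⁅⁆⁻ xs x∈xs))

minElem-⁅⁆ : ∀ {k} (a : Fin k) → minElem ⁅ a ⁆ ≡ toℕ a
minElem-⁅⁆ fzero    = refl
minElem-⁅⁆ (fsuc a) = cong suc (minElem-⁅⁆ a)

-- α and the two orders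

αblock-inside : ∀ {n} (S : Subset n) → αblock (inside ∷ S) ≡ dot ∣ S ∣
αblock-inside S = cong (dot ∘ ∣_∣) (p─⊥≡p S)

αblock-outside : ∀ {n} (S : Subset n) → αblock (outside ∷ S) ≡ undot ∣ S ∣
αblock-outside S = cong (undot ∘ ∣_∣) (p─⊥≡p S)

αc-cover : ∀ {n} {J K : List (Block n)} → CoverS J K → CoverD (αc J) (αc K)
αc-cover (there J→K)                     = there (αc-cover J→K)
αc-cover (here {inside ∷ _} 0∉B _ _)     = ⊥-elim (0∉B here)
αc-cover (here {_} {inside ∷ _} _ 0∉C _) = ⊥-elim (0∉C here)
αc-cover (here {outside ∷ S} {outside ∷ T} _ _ B<C)
  rewrite αblock-outside S | αblock-outside T | αblock-outside (S ∪ T)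
        | ∣p∪q∣≡∣p∣+∣q∣ S T (λ x∈S x∈T → ℕ.<-irrefl refl (B<C _ _ (there x∈S) (there x∈T)))
  = here

αc-mono : ∀ {n} {J K : List (Block n)} → J ⪯ K → αc J ⊑ αc K
αc-mono = gmap αc αc-cover

⪯-∷ : ∀ {n} (B : Block n) {J K} → J ⪯ K → (B ∷ J) ⪯ (B ∷ K)
⪯-∷ B = gmap (B ∷_) there

⊑-∷ : ∀ e {x y} → x ⊑ y → (e ∷ x) ⊑ (e ∷ y)
⊑-∷ e = gmap (e ∷_) there

⊑-suc-head : ∀ {m k x y} → (undot m ∷ x) ⊑ (undot k ∷ y) → (undot (suc m) ∷ x) ⊑ (undot (suc k) ∷ y)
⊑-suc-head ε                   = ε
⊑-suc-head (here      ◅ steps) = here ◅ ⊑-suc-head steps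
⊑-suc-head (there x→y ◅ steps) = there x→y ◅ ⊑-suc-head steps

cover-pos : ∀ {x y} → All PosEntry x → CoverD x y → All PosEntry y
cover-pos (0<a ∷ _ ∷ px) here        = ℕ.≤-trans 0<a (ℕ.m≤m+n _ _) ∷ px
cover-pos (pe ∷ px)      (there x→y) = pe ∷ cover-pos px x→y

undot-injective : ∀ {a b} → undot a ≡ undot b → a ≡ b
undot-injective refl = refl

-- Descents

oneTo≡map-suc-upTo : ∀ k → oneTo k ≡ map suc (upTo k)
oneTo≡map-suc-upTo zero    = refl
oneTo≡map-suc-upTo (suc k) = begin
  oneTo k ++ [ suc k ]          ≡⟨ cong (_++ [ suc k ]) (oneTo≡map-suc-upTo k) ⟩
  map suc (upTo k) ++ [ suc k ] ≡⟨ sym (map-++ suc (upTo k) [ k ]) ⟩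
  map suc (upTo k ++ [ k ])     ≡⟨ cong (map suc) (upTo-∷ʳ k) ⟩
  map suc (upTo (suc k))        ∎

descentAt? : (as : List ℕ) → Decidable (λ r → at as (suc r) ℕ.< at as r)
descentAt? as r = at as (suc r) ℕ.<? at as r

-- Descent positions counted from 0, which removes the truncated subtraction d ∸ 1 from descents.
descents₀ : List ℕ → List ℕ
descents₀ as = filter (descentAt? as) (upTo (length as ∸ 1))

descents≡map-suc-descents₀ : ∀ as → descents as ≡ map suc (descents₀ as)
descents≡map-suc-descents₀ as =
  trans (cong (filter _) (oneTo≡map-suc-upTo (length as ∸ 1))) (filter-map suc _ (upTo (length as ∸ 1)))

module _ {a b : ℕ} (s : List ℕ) where

  private
    later : List ℕ
    later = filter (descentAt? (a ∷ b ∷ s)) (applyUpTo suc (length s))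

    map-suc-later : map suc later ≡ map suc (descents (b ∷ s))
    map-suc-later = cong (map suc) (begin
      later
        ≡⟨ cong (filter _) (sym (map-applyUpTo id suc (length s))) ⟩
      filter (descentAt? (a ∷ b ∷ s)) (map suc (upTo (length s)))
        ≡⟨ filter-map suc _ (upTo (length s)) ⟩
      map suc (descents₀ (b ∷ s))
        ≡⟨ sym (descents≡map-suc-descents₀ (b ∷ s)) ⟩
      descents (b ∷ s) ∎)

  descents-descent : b ℕ.< a → descents (a ∷ b ∷ s) ≡ 1 ∷ map suc (descents (b ∷ s))
  descents-descent b<a = begin
    descents (a ∷ b ∷ s)            ≡⟨ descents≡map-suc-descents₀ (a ∷ b ∷ s) ⟩
    map suc (descents₀ (a ∷ b ∷ s)) ≡⟨ cong (map suc) (filter-accept (descentAt? (a ∷ b ∷ s)) {x = 0} b<a) ⟩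
    1 ∷ map suc later               ≡⟨ cong (1 ∷_) map-suc-later ⟩
    1 ∷ map suc (descents (b ∷ s))  ∎

  descents-ascent : ¬ b ℕ.< a → descents (a ∷ b ∷ s) ≡ map suc (descents (b ∷ s))
  descents-ascent b≮a = begin
    descents (a ∷ b ∷ s)            ≡⟨ descents≡map-suc-descents₀ (a ∷ b ∷ s) ⟩
    map suc (descents₀ (a ∷ b ∷ s)) ≡⟨ cong (map suc) (filter-reject (descentAt? (a ∷ b ∷ s)) {x = 0} b≮a) ⟩
    map suc later                   ≡⟨ map-suc-later ⟩
    map suc (descents (b ∷ s))      ∎

diffs-suc : ∀ p xs → diffs (suc p) (map suc xs) ≡ diffs p xs
diffs-suc p []       = refl
diffs-suc p (x ∷ xs) = cong (x ∸ p ∷_) (diffs-suc x xs)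

incHead : List ℕ → List ℕ
incHead []       = []
incHead (x ∷ xs) = suc x ∷ xs

diffs-zero-suc : ∀ xs → diffs 0 (map suc xs) ≡ incHead (diffs 0 xs)
diffs-zero-suc []       = refl
diffs-zero-suc (x ∷ xs) = cong (suc x ∷_) (diffs-suc x xs)

incHead-undot : ∀ {ns k x} → map undot ns ≡ undot k ∷ x → map undot (incHead ns) ≡ undot (suc k) ∷ x
incHead-undot {_ ∷ _} eq with refl , refl ← ∷-injective eq = refl

module _ {a b : ℕ} (s : List ℕ) where

  private
    D = descents (b ∷ s)

    shift-end : map suc D ++ [ 2 + length s ] ≡ map suc (D ++ [ 1 + length s ])
    shift-end = sym (map-++ suc D [ 1 + length s ])

  segComp-descent : b ℕ.< a → segComp (a ∷ b ∷ s) ≡ 1 ∷ segComp (b ∷ s)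
  segComp-descent b<a = begin
    diffs 0 (descents (a ∷ b ∷ s) ++ [ 2 + length s ])
      ≡⟨ cong (λ ds → diffs 0 (ds ++ _)) (descents-descent s b<a) ⟩
    1 ∷ diffs 1 (map suc D ++ [ 2 + length s ])
      ≡⟨ cong (λ ds → 1 ∷ diffs 1 ds) shift-end ⟩
    1 ∷ diffs 1 (map suc (D ++ [ 1 + length s ]))
      ≡⟨ cong (1 ∷_) (diffs-suc 0 _) ⟩
    1 ∷ segComp (b ∷ s) ∎

  segComp-ascent : ¬ b ℕ.< a → segComp (a ∷ b ∷ s) ≡ incHead (segComp (b ∷ s))
  segComp-ascent b≮a = begin
    diffs 0 (descents (a ∷ b ∷ s) ++ [ 2 + length s ])
      ≡⟨ cong (λ ds → diffs 0 (ds ++ _)) (descents-ascent s b≮a) ⟩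
    diffs 0 (map suc D ++ [ 2 + length s ])
      ≡⟨ cong (diffs 0) shift-end ⟩
    diffs 0 (map suc (D ++ [ 1 + length s ]))
      ≡⟨ diffs-zero-suc _ ⟩
    incHead (segComp (b ∷ s)) ∎

-- Chunkings of a word

-- A block is inside ∷ S = {0} ∪ (S + 1) or outside ∷ S = S + 1 with S ⊆ Fin n; in a superpermutation
-- the latter are singletons outside ∷ ⁅ a ⁆ = {a + 1}.
data Token (n : ℕ) : Set where
  fermion : Subset n → Token n
  single  : Fin n → Token n

tokenBlock : ∀ {n} → Token n → Block n
tokenBlock (fermion S) = inside ∷ S
tokenBlock (single a)  = outside ∷ ⁅ a ⁆

data Chunk (n : ℕ) : Set where
  ferm : Subset n → Chunk n
  run  : List (Fin n) → Chunk n

data ValidChunk {n : ℕ} : Chunk n → Set where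
  ferm : ∀ {S} → ValidChunk (ferm S)
  run  : ∀ {a as} → AllPairs Fin._<_ (a ∷ as) → ValidChunk (run (a ∷ as))

chunkBlock : ∀ {n} → Chunk n → Block n
chunkBlock (ferm S) = inside ∷ S
chunkBlock (run xs) = outside ∷ ⋃ (map ⁅_⁆ xs)

chunkEntry : ∀ {n} → Chunk n → Entry
chunkEntry (ferm S) = dot ∣ S ∣
chunkEntry (run xs) = undot (length xs)

chunkWord : ∀ {n} → Chunk n → List (Token n)
chunkWord (ferm S) = [ fermion S ]
chunkWord (run xs) = map single xs

word : ∀ {n} → List (Chunk n) → List (Token n)
word = concatMap chunkWord

blocks : ∀ {n} → List (Chunk n) → List (Block n)
blocks = map chunkBlock

entries : ∀ {n} → List (Chunk n) → List Entry
entries = map chunkEntry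

valid-run : ∀ {n} {xs : List (Fin n)} → 0 ℕ.< length xs → AllPairs Fin._<_ xs → ValidChunk (run xs)
valid-run {xs = _ ∷ _} _ increasing = run increasing

run-increasing : ∀ {n} {xs : List (Fin n)} → ValidChunk (run xs) → AllPairs Fin._<_ xs
run-increasing (run increasing) = increasing

entries-pos : ∀ {n} {c : List (Chunk n)} → All ValidChunk c → All PosEntry (entries c)
entries-pos []           = []
entries-pos (ferm ∷ vc)  = tt ∷ entries-pos vc
entries-pos (run _ ∷ vc) = ℕ.s≤s ℕ.z≤n ∷ entries-pos vc

αc-blocks : ∀ {n} {c : List (Chunk n)} → All ValidChunk c → αc (blocks c) ≡ entries c
αc-blocks []                              = refl
αc-blocks (ferm {S} ∷ vc)                 = cong₂ _∷_ (αblock-inside S) (αc-blocks vc)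
αc-blocks (run {a} {as} increasing ∷ vc) =
  cong₂ _∷_ (trans (αblock-outside (⋃ (map ⁅_⁆ (a ∷ as)))) (cong undot (∣⋃⁅⁆∣ increasing))) (αc-blocks vc)

run-∪ : ∀ {n} (xs ys : List (Fin n)) → chunkBlock (run xs) ∪ chunkBlock (run ys) ≡ chunkBlock (run (xs ++ ys))
run-∪ xs ys = cong (outside ∷_) (sym (trans (cong ⋃ (map-++ ⁅_⁆ xs ys)) (⋃-++ (map ⁅_⁆ xs) (map ⁅_⁆ ys))))

word-run-++ : ∀ {n} (xs ys : List (Fin n)) c → word (run xs ∷ run ys ∷ c) ≡ word (run (xs ++ ys) ∷ c)
word-run-++ xs ys c = sym (trans (cong (_++ word c) (map-++ single xs ys)) (++-assoc (map single xs) _ _))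

merge-runs : ∀ {n} (xs : List (Fin n)) {ys R} → AllPairs Fin._<_ (xs ++ ys) →
             CoverS (chunkBlock (run xs) ∷ chunkBlock (run ys) ∷ R) (chunkBlock (run (xs ++ ys)) ∷ R)
merge-runs xs {ys} {R} increasing =
  subst (λ B → CoverS (chunkBlock (run xs) ∷ chunkBlock (run ys) ∷ R) (B ∷ R)) (run-∪ xs ys)
    (here (λ ()) (λ ()) ordered)
  where
  ordered : ∀ x y → x ∈ chunkBlock (run xs) → y ∈ chunkBlock (run ys) → toℕ x ℕ.< toℕ y
  ordered _ _ (there x∈xs) (there y∈ys) with _ , _ , xs<ys ← AllPairs-++⁻ xs increasing =
    ℕ.s<s (All.lookup (All.lookup xs<ys (∈⋃⁅⁆⁻ xs x∈xs)) (∈⋃⁅⁆⁻ ys y∈ys))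

cover-blocks : ∀ {n} {K : List (Block n)} (c : List (Chunk n)) → All ValidChunk c → CoverS (blocks c) K →
               ∃ λ c′ → All ValidChunk c′ × word c′ ≡ word c × K ≡ blocks c′
cover-blocks (ferm _ ∷ _ ∷ _)     _ (here 0∉B _ _) = ⊥-elim (0∉B here)
cover-blocks (run _ ∷ ferm _ ∷ _) _ (here _ 0∉C _) = ⊥-elim (0∉C here)
cover-blocks (run xs ∷ run ys ∷ c) (run incx ∷ run incy ∷ vc) (here _ _ ordered) =
  run (xs ++ ys) ∷ c , run (AllPairsₚ.++⁺ incx incy xs<ys) ∷ vc ,
  sym (word-run-++ xs ys c) , cong (_∷ blocks c) (run-∪ xs ys)
  where
  xs<ys : All (λ x → All (x Fin.<_) ys) xs
  xs<ys = All.tabulate λ x∈xs → All.tabulate λ y∈ys →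
    ℕ.s<s⁻¹ (ordered _ _ (there (∈⋃⁅⁆⁺ x∈xs)) (there (∈⋃⁅⁆⁺ y∈ys)))
cover-blocks (k ∷ c) (vk ∷ vc) (there c→K) with cover-blocks c vc c→K
... | c′ , vc′ , w≡ , refl = k ∷ c′ , vk ∷ vc′ , cong (chunkWord k ++_) w≡ , refl

⪯-blocks : ∀ {n} {K : List (Block n)} (c : List (Chunk n)) → All ValidChunk c → blocks c ⪯ K →
           ∃ λ c′ → All ValidChunk c′ × word c′ ≡ word c × K ≡ blocks c′
⪯-blocks c vc ε = c , vc , refl , refl
⪯-blocks c vc (c→J ◅ J⪯K) with cover-blocks c vc c→J
... | c₁ , vc₁ , w₁ , refl with ⪯-blocks c₁ vc₁ J⪯K
... | c₂ , vc₂ , w₂ , K≡ = c₂ , vc₂ , trans w₂ w₁ , K≡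

single-prefix : ∀ {n} (xs ys : List (Fin n)) {u v} → length xs ≡ length ys →
                map single xs ++ u ≡ map single ys ++ v → xs ≡ ys × u ≡ v
single-prefix []       []       _   u≡v = refl , u≡v
single-prefix (x ∷ xs) (y ∷ ys) len eq with refl , eq′ ← ∷-injective eq
  with refl , u≡v ← single-prefix xs ys (ℕ.suc-injective len) eq′ = refl , u≡v

entries-injective : ∀ {n} {c d : List (Chunk n)} → All ValidChunk c → All ValidChunk d →
                    word c ≡ word d → entries c ≡ entries d → c ≡ d
entries-injective []          []          _  _ = refl
entries-injective (ferm ∷ vc) (ferm ∷ vd) w≡ e≡ with refl , w≡′ ← ∷-injective w≡ =
  cong (ferm _ ∷_) (entries-injective vc vd w≡′ (∷-injectiveʳ e≡))
entries-injective (run {a} {as} _ ∷ vc) (run {b} {bs} _ ∷ vd) w≡ e≡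
  with refl , w≡′ ← single-prefix (a ∷ as) (b ∷ bs) (undot-injective (∷-injectiveˡ e≡)) w≡ =
  cong (run (a ∷ as) ∷_) (entries-injective vc vd w≡′ (∷-injectiveʳ e≡))
entries-injective (ferm ∷ _)  (run _ ∷ _) _ ()
entries-injective (run _ ∷ _) (ferm ∷ _)  _ ()

cover-lift : ∀ {n} {x y} (c : List (Chunk n)) → All ValidChunk c → All PosEntry x →
             CoverD x y → y ≡ entries c →
             ∃ λ c′ → All ValidChunk c′ × word c′ ≡ word c × entries c′ ≡ x × CoverS (blocks c′) (blocks c)
cover-lift (ferm _ ∷ _) _ _ here ()
cover-lift (run zs ∷ c) (vz ∷ vc) (0<a ∷ 0<b ∷ _) (here {a}) eq
  with a+b≡ , refl ← ∷-injective eq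
  with p , q , refl , refl , refl ← split-lengths a zs (sym (undot-injective a+b≡))
  with incp , incq , _ ← AllPairs-++⁻ p (run-increasing vz) =
  run p ∷ run q ∷ c , valid-run 0<a incp ∷ valid-run 0<b incq ∷ vc ,
  word-run-++ p q c , refl , merge-runs p (run-increasing vz)
cover-lift (k ∷ c) (vk ∷ vc) (_ ∷ px) (there x→y) refl
  with c′ , vc′ , w≡ , refl , c′→c ← cover-lift c vc px x→y refl =
  k ∷ c′ , vk ∷ vc′ , cong (chunkWord k ++_) w≡ , refl , there c′→c

⊑-lift : ∀ {n} {x} (d : List (Chunk n)) → All ValidChunk d → All PosEntry x → x ⊑ entries d →
         ∃ λ c → All ValidChunk c × word c ≡ word d × entries c ≡ x × blocks c ⪯ blocks d
⊑-lift d vd _  ε = d , vd , refl , refl , ε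
⊑-lift d vd px (x→y ◅ y⊑d)
  with c₁ , vc₁ , w₁ , refl , c₁⪯d ← ⊑-lift d vd (cover-pos px x→y) y⊑d
  with c , vc , w , refl , c→c₁ ← cover-lift c₁ vc₁ px x→y refl =
  c , vc , trans w w₁ , refl , c→c₁ ◅ c₁⪯d

entries-⊑⇒blocks-⪯ : ∀ {n} {c d : List (Chunk n)} → All ValidChunk c → All ValidChunk d → word c ≡ word d →
                     entries c ⊑ entries d → blocks c ⪯ blocks d
entries-⊑⇒blocks-⪯ {d = d} vc vd w≡ c⊑d with c′ , vc′ , w′ , e′ , c′⪯d ← ⊑-lift d vd (entries-pos vc) c⊑d
  rewrite entries-injective vc′ vc (trans w′ (sym w≡)) e′ = c′⪯d

-- The finest and the coarsest chunking

finestChunk : ∀ {n} → Token n → Chunk n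
finestChunk (fermion S) = ferm S
finestChunk (single a)  = run [ a ]

finest : ∀ {n} → List (Token n) → List (Chunk n)
finest = map finestChunk

word-finest : ∀ {n} (w : List (Token n)) → word (finest w) ≡ w
word-finest []              = refl
word-finest (fermion S ∷ w) = cong (fermion S ∷_) (word-finest w)
word-finest (single a ∷ w)  = cong (single a ∷_) (word-finest w)

valid-finest : ∀ {n} (w : List (Token n)) → All ValidChunk (finest w)
valid-finest []              = []
valid-finest (fermion _ ∷ w) = ferm ∷ valid-finest w
valid-finest (single _ ∷ w)  = run ([] ∷ []) ∷ valid-finest w

blocks-finest : ∀ {n} (w : List (Token n)) → blocks (finest w) ≡ map tokenBlock w
blocks-finest []              = refl
blocks-finest (fermion S ∷ w) = cong ((inside ∷ S) ∷_) (blocks-finest w)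
blocks-finest (single a ∷ w)  = cong₂ _∷_ (cong (outside ∷_) (∪-identityʳ ⁅ a ⁆)) (blocks-finest w)

singles-⪯-run : ∀ {n} {a : Fin n} {as} → AllPairs Fin._<_ (a ∷ as) → ∀ w →
                blocks (finest (map single (a ∷ as) ++ w)) ⪯ (chunkBlock (run (a ∷ as)) ∷ blocks (finest w))
singles-⪯-run {as = []} _ w = ε
singles-⪯-run {a = a} {as = _ ∷ _} increasing@(_ ∷ increasing′) w =
  ⪯-∷ (chunkBlock (run [ a ])) (singles-⪯-run increasing′ w) ◅◅ merge-runs [ a ] increasing ◅ ε

finest-⪯ : ∀ {n} {c : List (Chunk n)} → All ValidChunk c → blocks (finest (word c)) ⪯ blocks c
finest-⪯ []                    = ε
finest-⪯ (ferm {S} ∷ vc)       = ⪯-∷ (inside ∷ S) (finest-⪯ vc)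
finest-⪯ (run increasing ∷ vc) = singles-⪯-run increasing _ ◅◅ ⪯-∷ _ (finest-⪯ vc)

-- a joins the following run unless b < a, since segComp cuts exactly at descents; hence the runs of
-- coarsest w increase only if neighbouring singletons of w are distinct.
prepend : ∀ {n} → Fin n → List (Chunk n) → List (Chunk n)
prepend a (run (b ∷ bs) ∷ c) = if toℕ b ℕ.<ᵇ toℕ a then run [ a ] ∷ run (b ∷ bs) ∷ c else run (a ∷ b ∷ bs) ∷ c
prepend a c                  = run [ a ] ∷ c

coarsest : ∀ {n} → List (Token n) → List (Chunk n)
coarsest []              = []
coarsest (fermion S ∷ w) = ferm S ∷ coarsest w
coarsest (single a ∷ w)  = prepend a (coarsest w)

module _ {n : ℕ} {a b : Fin n} {bs : List (Fin n)} {c : List (Chunk n)} where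

  prepend-descent : b Fin.< a → prepend a (run (b ∷ bs) ∷ c) ≡ run [ a ] ∷ run (b ∷ bs) ∷ c
  prepend-descent b<a with toℕ b ℕ.<ᵇ toℕ a | ℕ.<ᵇ-reflects-< (toℕ b) (toℕ a)
  ... | true  | _       = refl
  ... | false | ofⁿ b≮a = ⊥-elim (b≮a b<a)

  prepend-ascent : ¬ b Fin.< a → prepend a (run (b ∷ bs) ∷ c) ≡ run (a ∷ b ∷ bs) ∷ c
  prepend-ascent b≮a with toℕ b ℕ.<ᵇ toℕ a | ℕ.<ᵇ-reflects-< (toℕ b) (toℕ a)
  ... | true  | ofʸ b<a = ⊥-elim (b≮a b<a)
  ... | false | _       = refl

prepend-head : ∀ {n} (a : Fin n) c → ∃₂ λ as c′ → prepend a c ≡ run (a ∷ as) ∷ c′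
prepend-head a []                 = [] , [] , refl
prepend-head a (ferm S ∷ c)       = [] , ferm S ∷ c , refl
prepend-head a (run [] ∷ c)       = [] , run [] ∷ c , refl
prepend-head a (run (b ∷ bs) ∷ c) with toℕ b ℕ.<ᵇ toℕ a
... | true  = [] , run (b ∷ bs) ∷ c , refl
... | false = b ∷ bs , c , refl

word-prepend : ∀ {n} (a : Fin n) c → word (prepend a c) ≡ single a ∷ word c
word-prepend a []                 = refl
word-prepend a (ferm _ ∷ _)       = refl
word-prepend a (run [] ∷ _)       = refl
word-prepend a (run (b ∷ bs) ∷ c) with toℕ b ℕ.<ᵇ toℕ a
... | true  = refl
... | false = refl

word-coarsest : ∀ {n} (w : List (Token n)) → word (coarsest w) ≡ w
word-coarsest []              = refl
word-coarsest (fermion S ∷ w) = cong (fermion S ∷_) (word-coarsest w)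
word-coarsest (single a ∷ w)  = trans (word-prepend a (coarsest w)) (cong (single a ∷_) (word-coarsest w))

DistinctSingles : ∀ {n} → Token n → Token n → Set
DistinctSingles (single a) (single b) = a ≢ b
DistinctSingles _          _          = ⊤

prepend-valid : ∀ {n} {a b : Fin n} {bs c} → a ≢ b → All ValidChunk (run (b ∷ bs) ∷ c) →
                All ValidChunk (prepend a (run (b ∷ bs) ∷ c))
prepend-valid {a = a} {b} a≢b vc@(run (b<bs ∷ increasing) ∷ vc′)
  with toℕ b ℕ.<ᵇ toℕ a | ℕ.<ᵇ-reflects-< (toℕ b) (toℕ a)
... | true  | _       = run ([] ∷ []) ∷ vc
... | false | ofⁿ b≮a = run ((a<b ∷ All.map (ℕ.<-trans a<b) b<bs) ∷ b<bs ∷ increasing) ∷ vc′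
  where a<b = Finₚ.≤∧≢⇒< (ℕ.≮⇒≥ b≮a) a≢b

valid-coarsest : ∀ {n} {w : List (Token n)} → Linked DistinctSingles w → All ValidChunk (coarsest w)
valid-coarsest []                                     = []
valid-coarsest {w = fermion _ ∷ _} [-]                = ferm ∷ []
valid-coarsest {w = single _ ∷ _}  [-]                = run ([] ∷ []) ∷ []
valid-coarsest {w = fermion _ ∷ _} (_ ∷ l)            = ferm ∷ valid-coarsest l
valid-coarsest {w = single _ ∷ fermion _ ∷ _} (_ ∷ l) = run ([] ∷ []) ∷ valid-coarsest l
valid-coarsest {w = single a ∷ single b ∷ w} (a≢b ∷ l)
  with prepend b (coarsest w) | prepend-head b (coarsest w) | valid-coarsest l
... | _ | bs , c , refl | vc = prepend-valid a≢b vc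

single-⊑-prepend : ∀ {n} (a : Fin n) c → (undot 1 ∷ entries c) ⊑ entries (prepend a c)
single-⊑-prepend a []                 = ε
single-⊑-prepend a (ferm _ ∷ _)       = ε
single-⊑-prepend a (run [] ∷ _)       = ε
single-⊑-prepend a (run (b ∷ bs) ∷ c) with toℕ b ℕ.<ᵇ toℕ a
... | true  = ε
... | false = here ◅ ε

run-⊑-prepend : ∀ {n} {a : Fin n} {as} → AllPairs Fin._<_ (a ∷ as) → ∀ w →
                (undot (length (a ∷ as)) ∷ entries (coarsest w))
                  ⊑ entries (coarsest (map single (a ∷ as) ++ w))
run-⊑-prepend {a = a} {[]} _ w = single-⊑-prepend a (coarsest w)
run-⊑-prepend {as = b ∷ bs} ((a<b ∷ _) ∷ increasing) w
  with prepend b (coarsest (map single bs ++ w)) | prepend-head b (coarsest (map single bs ++ w))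
     | run-⊑-prepend increasing w
... | _ | bs′ , c , refl | ih rewrite prepend-ascent {bs = bs′} {c} (ℕ.<-asym a<b) = ⊑-suc-head ih

⊑-coarsest : ∀ {n} {c : List (Chunk n)} → All ValidChunk c → entries c ⊑ entries (coarsest (word c))
⊑-coarsest []                    = ε
⊑-coarsest (ferm ∷ vc)           = ⊑-∷ _ (⊑-coarsest vc)
⊑-coarsest (run increasing ∷ vc) = ⊑-∷ _ (⊑-coarsest vc) ◅◅ run-⊑-prepend increasing _

segComp-coarsest : ∀ {n} (a : Fin n) s →
                   map undot (segComp (map (suc ∘ toℕ) (a ∷ s))) ≡ entries (coarsest (map single (a ∷ s)))
segComp-coarsest a []      = refl
segComp-coarsest a (b ∷ s)
  with prepend b (coarsest (map single s)) | prepend-head b (coarsest (map single s)) | segComp-coarsest b s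
... | _ | bs , c , refl | ih with toℕ b ℕ.<? toℕ a
... | yes b<a = begin
  map undot (segComp (suc (toℕ a) ∷ suc (toℕ b) ∷ map (suc ∘ toℕ) s))
    ≡⟨ cong (map undot) (segComp-descent (map (suc ∘ toℕ) s) (ℕ.s<s b<a)) ⟩
  undot 1 ∷ map undot (segComp (suc (toℕ b) ∷ map (suc ∘ toℕ) s))
    ≡⟨ cong (undot 1 ∷_) ih ⟩
  entries (run [ a ] ∷ run (b ∷ bs) ∷ c)
    ≡⟨ cong entries (sym (prepend-descent b<a)) ⟩
  entries (prepend a (run (b ∷ bs) ∷ c)) ∎
... | no b≮a = begin
  map undot (segComp (suc (toℕ a) ∷ suc (toℕ b) ∷ map (suc ∘ toℕ) s))
    ≡⟨ cong (map undot) (segComp-ascent (map (suc ∘ toℕ) s) (b≮a ∘ ℕ.s<s⁻¹)) ⟩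
  map undot (incHead (segComp (suc (toℕ b) ∷ map (suc ∘ toℕ) s)))
    ≡⟨ incHead-undot ih ⟩
  entries (run (a ∷ b ∷ bs) ∷ c)
    ≡⟨ cong entries (sym (prepend-ascent b≮a)) ⟩
  entries (prepend a (run (b ∷ bs) ∷ c)) ∎

flush-coarsest : ∀ {n} (seg : List (Fin n)) →
                 flush (map (suc ∘ toℕ) seg) ≡ entries (coarsest (map single seg))
flush-coarsest []      = refl
flush-coarsest (a ∷ s) = segComp-coarsest a s

prepend-++-ferm : ∀ {n} (a : Fin n) c S d → prepend a (c ++ ferm S ∷ d) ≡ prepend a c ++ ferm S ∷ d
prepend-++-ferm a []                 S d = refl
prepend-++-ferm a (ferm _ ∷ _)       S d = refl
prepend-++-ferm a (run [] ∷ _)       S d = refl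
prepend-++-ferm a (run (b ∷ bs) ∷ c) S d with toℕ b ℕ.<ᵇ toℕ a
... | true  = refl
... | false = refl

coarsest-++-fermion : ∀ {n} (seg : List (Fin n)) S w →
                      coarsest (map single seg ++ fermion S ∷ w)
                        ≡ coarsest (map single seg) ++ ferm S ∷ coarsest w
coarsest-++-fermion []        S w = refl
coarsest-++-fermion (a ∷ seg) S w =
  trans (cong (prepend a) (coarsest-++-fermion seg S w))
        (prepend-++-ferm a (coarsest (map single seg)) S (coarsest w))

γaux-coarsest : ∀ {n} (seg : List (Fin n)) w →
                γaux (map (suc ∘ toℕ) seg) (map tokenBlock w) ≡ entries (coarsest (map single seg ++ w))
γaux-coarsest seg [] =
  trans (flush-coarsest seg) (cong (entries ∘ coarsest) (sym (++-identityʳ (map single seg))))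
γaux-coarsest seg (fermion S ∷ w) = begin
  flush (map (suc ∘ toℕ) seg) ++ αblock (inside ∷ S) ∷ γaux [] (map tokenBlock w)
    ≡⟨ cong₂ _++_ (flush-coarsest seg) (cong₂ _∷_ (αblock-inside S) (γaux-coarsest [] w)) ⟩
  entries (coarsest (map single seg)) ++ entries (ferm S ∷ coarsest w)
    ≡⟨ sym (map-++ chunkEntry (coarsest (map single seg)) (ferm S ∷ coarsest w)) ⟩
  entries (coarsest (map single seg) ++ ferm S ∷ coarsest w)
    ≡⟨ cong entries (sym (coarsest-++-fermion seg S w)) ⟩
  entries (coarsest (map single seg ++ fermion S ∷ w)) ∎
γaux-coarsest seg (single a ∷ w) = begin
  γaux (map (suc ∘ toℕ) seg ++ [ suc (minElem ⁅ a ⁆) ]) (map tokenBlock w)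
    ≡⟨ cong (λ x → γaux (map (suc ∘ toℕ) seg ++ [ suc x ]) (map tokenBlock w)) (minElem-⁅⁆ a) ⟩
  γaux (map (suc ∘ toℕ) seg ++ map (suc ∘ toℕ) [ a ]) (map tokenBlock w)
    ≡⟨ cong (λ xs → γaux xs (map tokenBlock w)) (sym (map-++ (suc ∘ toℕ) seg [ a ])) ⟩
  γaux (map (suc ∘ toℕ) (seg ++ [ a ])) (map tokenBlock w)
    ≡⟨ γaux-coarsest (seg ++ [ a ]) w ⟩
  entries (coarsest (map single (seg ++ [ a ]) ++ w))
    ≡⟨ cong (entries ∘ coarsest)
            (trans (cong (_++ w) (map-++ single seg [ a ])) (++-assoc (map single seg) _ w)) ⟩
  entries (coarsest (map single seg ++ single a ∷ w)) ∎

γ-coarsest : ∀ {n} (w : List (Token n)) → γ (map tokenBlock w) ≡ entries (coarsest w)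
γ-coarsest = γaux-coarsest []

-- Superpermutations as words

block-token : ∀ {n} (B : Block n) → (fzero ∉ B → ∃ λ a → B ≡ ⁅ a ⁆) → ∃ λ t → tokenBlock t ≡ B
block-token (inside ∷ S)  _         = fermion S , refl
block-token (outside ∷ S) singleton with singleton (λ ())
... | fzero  , ()
... | fsuc a , refl = single a , refl

tokens : ∀ {n} {I : List (Block n)} → All (λ B → fzero ∉ B → ∃ λ a → B ≡ ⁅ a ⁆) I →
         ∃ λ w → map tokenBlock w ≡ I
tokens []                    = [] , refl
tokens {I = B ∷ _} (sB ∷ sI) with t , refl ← block-token B sB with w , refl ← tokens sI = t ∷ w , refl

adjacent-disjoint : ∀ {n m I} → IsSetSupercomp n m I → Linked (λ B C → ∀ x → x ∈ B → x ∈ C → x ≡ fzero) I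
adjacent-disjoint {I = I} ssc = Linkedₚ.AllPairs⇒Linked
  (subst (AllPairs _) (tabulate-lookup I) (AllPairsₚ.tabulate⁺ (IsSetSupercomp.disjoint ssc _ _)))

apart : ∀ {n} {t u : Token n} → (∀ x → x ∈ tokenBlock t → x ∈ tokenBlock u → x ≡ fzero) → DistinctSingles t u
apart {t = single a} {single b} disjoint refl with () ← disjoint (fsuc a) (there (x∈⁅x⁆ a)) (there (x∈⁅x⁆ a))
apart {t = fermion _}            _ = tt
apart {t = single _} {fermion _} _ = tt

superperm-word : ∀ {n m I} → IsSuperperm n m I → ∃ λ w → map tokenBlock w ≡ I × Linked DistinctSingles w
superperm-word sp with w , refl ← tokens (IsSuperperm.singletons sp) =
  w , refl , Linked.map apart (Linkedₚ.map⁻ (adjacent-disjoint (IsSuperperm.setSupercomp sp)))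

chunking-above : ∀ {n} (w : List (Token n)) {J} → map tokenBlock w ⪯ J →
                 ∃ λ c → All ValidChunk c × word c ≡ w × J ≡ blocks c
chunking-above w I⪯J
  with c , vc , w≡ , J≡ ← ⪯-blocks (finest w) (valid-finest w) (subst (_⪯ _) (sym (blocks-finest w)) I⪯J) =
  c , vc , trans w≡ (word-finest w) , J≡

module _ {n : ℕ} (w : List (Token n)) where

  private
    I = map tokenBlock w

  αc-below-γ : ∀ J → I ⪯ J → αc J ⊑ γ I
  αc-below-γ J I⪯J with c , vc , refl , refl ← chunking-above w I⪯J =
    subst₂ _⊑_ (sym (αc-blocks vc)) (sym (γ-coarsest (word c))) (⊑-coarsest vc)

  αc-injective : ∀ J J′ → I ⪯ J → I ⪯ J′ → αc J ≡ αc J′ → J ≡ J′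
  αc-injective J J′ I⪯J I⪯J′ α≡
    with c , vc , w≡ , refl ← chunking-above w I⪯J
    with c′ , vc′ , w≡′ , refl ← chunking-above w I⪯J′ =
    cong blocks (entries-injective vc vc′ (trans w≡ (sym w≡′))
                                   (trans (sym (αc-blocks vc)) (trans α≡ (αc-blocks vc′))))

  αc-surjective : Linked DistinctSingles w → ∀ β → IsDotComp β → β ⊑ γ I → ∃ λ J → I ⪯ J × αc J ≡ β
  αc-surjective distinct β β-comp β⊑γ
    with c , vc , w≡ , refl , _ ←
           ⊑-lift (coarsest w) (valid-coarsest distinct) β-comp (subst (β ⊑_) (γ-coarsest w) β⊑γ) =
    blocks c , subst (_⪯ blocks c) finest≡I (finest-⪯ vc) , αc-blocks vc
    where
    finest≡I : blocks (finest (word c)) ≡ I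
    finest≡I = trans (cong (blocks ∘ finest) (trans w≡ (word-coarsest w))) (blocks-finest w)

  αc-order : ∀ J J′ → I ⪯ J → I ⪯ J′ → (J ⪯ J′ ⇔ αc J ⊑ αc J′)
  αc-order J J′ I⪯J I⪯J′
    with c , vc , w≡ , refl ← chunking-above w I⪯J
    with c′ , vc′ , w≡′ , refl ← chunking-above w I⪯J′ =
    mk⇔ αc-mono (entries-⊑⇒blocks-⪯ vc vc′ (trans w≡ (sym w≡′)) ∘ subst₂ _⊑_ (αc-blocks vc) (αc-blocks vc′))

proposition5p2 : ∀ (n m : ℕ) (I : List (Block n)) → IsSuperperm n m I →
    (∀ J → I ⪯ J → αc J ⊑ γ I)
    × (∀ J J' → I ⪯ J → I ⪯ J' → αc J ≡ αc J' → J ≡ J')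
    × (∀ β → IsDotComp β → β ⊑ γ I → ∃ λ J → I ⪯ J × αc J ≡ β)
    × (∀ J J' → I ⪯ J → I ⪯ J' → (J ⪯ J' ⇔ αc J ⊑ αc J'))
proposition5p2 n m I sp with w , refl , distinct ← superperm-word sp =
  αc-below-γ w , αc-injective w , αc-surjective w distinct , αc-order w
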